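{- Let $F$ be a rooted forest and let $s$ be the number of vertices in the stem of $F$. Then $s=p_F'(1)=-\left.\frac{\partial P_F}{\partial x}\right|_{(x,y)=(1,-1)}$; in particular this partial derivative is zero if $F$ is not a tree.
   Context: A rooted forest is a finite, possibly empty, disjoint union of rooted trees. A leaf is a vertex with no children. A leaf-induced subforest of $F$ is a (possibly empty) union of paths connecting roots of components of $F$ to leaves of $F$; $P_F(x,y)=\sum_{F'}x^{|V(F')|}y^{|L(F')|}$ over leaf-induced subforests $F'$ (vertex and leaf counts), and $p_F(x):=1-P_F(x,-1)$. The stem of a rooted tree is constructed iteratively: include the root; while the last included vertex has exactly one child, include that child; otherwise stop. The stem of a rooted forest with zero or at least two components is defined to be empty. -}

module Defs where

open import Data.Nat using (ℕ; zero; suc; _∸_) renaming (_+_ to _+ℕ_)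
open import Data.Integer using (ℤ; +_; _+_; _*_; -_; _-_; _^_)
open import Data.List using (List; []; _∷_; map; concatMap; length)
open import Data.Maybe using (Maybe; just; nothing; maybe)
open import Data.Product using (_×_; _,_)

data Tree : Set where
  node : List Tree → Tree

Forest : Set
Forest = List Tree

mutual
  verticesT : Tree → ℕ
  verticesT (node ts) = suc (verticesF ts)

  verticesF : Forest → ℕ
  verticesF [] = 0
  verticesF (t ∷ ts) = verticesT t +ℕ verticesF ts

mutual
  leavesT : Tree → ℕ
  leavesT (node []) = 1
  leavesT (node (t ∷ ts)) = leavesF (t ∷ ts)

  leavesF : Forest → ℕ
  leavesF [] = 0
  leavesF (t ∷ ts) = leavesT t +ℕ leavesF ts

-- A leaf-induced subforest is the union of the
-- root-to-leaf paths ending at a chosen set S of leaves of F.  We enumerate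
-- all choices of S (each leaf either chosen or not) and return the resulting
-- subforest (the union of the paths, as a rooted forest whose roots are
-- roots of F).  Distinct choices of S yield distinct subforests (the leaves
-- of the union are exactly the chosen leaves), so this list enumerates each
-- leaf-induced subforest exactly once.
--   subT t : for each choice of leaves of t, the part of the union inside t
--            (nothing if no leaf of t was chosen).
--   subF F : for each choice of leaves of F, the union of paths.
mutual
  subT : Tree → List (Maybe Tree)
  subT (node []) = nothing ∷ just (node []) ∷ []
  subT (node (t ∷ ts)) = map wrap (subF (t ∷ ts))
    where
      wrap : Forest → Maybe Tree
      wrap [] = nothing
      wrap (u ∷ us) = just (node (u ∷ us))

  subF : Forest → List Forest
  subF [] = [] ∷ []
  subF (t ∷ ts) =
    concatMap (λ m → map (λ f → maybe (_∷ f) f m) (subF ts)) (subT t)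

-- Polynomials in two variables x, y with integer coefficients, represented
-- as lists of monomials (c , a , b) standing for c * x^a * y^b.
Poly2 : Set
Poly2 = List (ℤ × ℕ × ℕ)

P : Forest → Poly2
P F = map (λ F' → (+ 1 , verticesF F' , leavesF F')) (subF F)

dxEval : Poly2 → ℤ → ℤ → ℤ
dxEval [] x y = + 0
dxEval ((c , a , b) ∷ ms) x y = c * (+ a) * (x ^ (a ∸ 1)) * (y ^ b) + dxEval ms x y

-- Polynomials in one variable: lists of monomials (c , a) meaning c * x^a.
Poly1 : Set
Poly1 = List (ℤ × ℕ)

derivEval : Poly1 → ℤ → ℤ
derivEval [] x = + 0
derivEval ((c , a) ∷ ms) x = c * (+ a) * (x ^ (a ∸ 1)) + derivEval ms x

-- p_F(x) = 1 - P_F(x, -1)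
p : Forest → Poly1
p F = (+ 1 , 0) ∷ map (λ { (c , a , b) → (- (c * ((- (+ 1)) ^ b)) , a) }) (P F)

-- Stem: include the root; while the last included vertex has exactly one
-- child, include that child.  Empty for forests with 0 or ≥ 2 components.
stemT : Tree → ℕ
stemT (node (c ∷ [])) = suc (stemT c)
stemT (node _) = 1

stem : Forest → ℕ
stem (t ∷ []) = stemT t
stem _ = 0

{-# OPTIONS --safe #-}
module Submission where

-- Write E(F) = P_F(1,-1) and D(F) = ∂ₓP_F(1,-1) as signed sums over the
-- leaf-induced subforests of F.  A subforest of t ∷ ts is an independent choice of
-- one of t and one of ts, so E is multiplicative and D obeys the Leibniz rule.
-- The subforests of a tree with children are those of its children, with the
-- root added when nonempty; a leaf contributes 1 - 1 to E, so E vanishes on every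
-- tree and D(tree) = D(children) + E(children) - 1.  Induction gives D = -stem,
-- and p_F'(1) = -D.

open import Defs
open import Data.Nat using (ℕ; suc; _∸_) renaming (_+_ to _+ℕ_)
open import Data.Nat.Properties using () renaming (+-assoc to +ℕ-assoc; +-identityʳ to +ℕ-identityʳ)
open import Data.Integer using (ℤ; 1ℤ; -1ℤ; +_; -_; _+_; _*_; _-_; _^_)
open import Data.Integer.Properties
  using ( +-identityˡ; pos-+; ^-distribˡ-+-*; ^-zeroˡ; *-identityˡ; *-identityʳ; *-zeroʳ
        ; neg-distrib-+; neg-involutive)
open import Data.List using (List; []; _∷_; map; concatMap; length; _++_)
open import Data.Maybe using (Maybe; just; nothing; maybe)
open import Data.Empty using (⊥-elim)
open import Data.Product using (_×_; _,_)
open import Function using (_∘_)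
open import Relation.Binary.PropositionalEquality
  using (_≡_; _≢_; refl; sym; trans; cong; cong₂; module ≡-Reasoning)
open import Data.Integer.Solver using (module +-*-Solver)
open +-*-Solver using (solve; con; _:+_; _:*_; :-_; _:=_)

open ≡-Reasoning

∑ : {A : Set} → List A → (A → ℤ) → ℤ
∑ [] w = + 0
∑ (x ∷ xs) w = w x + ∑ xs w

module _ {A : Set} where

  ∑-cong : (xs : List A) {u v : A → ℤ} → (∀ a → u a ≡ v a) → ∑ xs u ≡ ∑ xs v
  ∑-cong [] e = refl
  ∑-cong (x ∷ xs) e = cong₂ _+_ (e x) (∑-cong xs e)

  ∑-++ : (xs ys : List A) (w : A → ℤ) → ∑ (xs ++ ys) w ≡ ∑ xs w + ∑ ys w
  ∑-++ [] ys w = sym (+-identityˡ (∑ ys w))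
  ∑-++ (x ∷ xs) ys w = trans (cong (_+_ (w x)) (∑-++ xs ys w))
    (solve 3 (λ a b c → a :+ (b :+ c) := (a :+ b) :+ c) refl (w x) (∑ xs w) (∑ ys w))

  ∑-+ : (xs : List A) (u v : A → ℤ) → ∑ xs (λ a → u a + v a) ≡ ∑ xs u + ∑ xs v
  ∑-+ [] u v = refl
  ∑-+ (x ∷ xs) u v = trans (cong (_+_ (u x + v x)) (∑-+ xs u v))
    (solve 4 (λ a b c d → (a :+ b) :+ (c :+ d) := (a :+ c) :+ (b :+ d)) refl
      (u x) (v x) (∑ xs u) (∑ xs v))

  ∑-neg : (xs : List A) (u : A → ℤ) → ∑ xs (λ a → - u a) ≡ - ∑ xs u
  ∑-neg [] u = refl
  ∑-neg (x ∷ xs) u = trans (cong (_+_ (- u x)) (∑-neg xs u)) (sym (neg-distrib-+ (u x) (∑ xs u)))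

  ∑-*ˡ : (xs : List A) (c : ℤ) (u : A → ℤ) → ∑ xs (λ a → c * u a) ≡ c * ∑ xs u
  ∑-*ˡ [] c u = sym (*-zeroʳ c)
  ∑-*ˡ (x ∷ xs) c u = trans (cong (_+_ (c * u x)) (∑-*ˡ xs c u))
    (solve 3 (λ a b c → c :* a :+ c :* b := c :* (a :+ b)) refl (u x) (∑ xs u) c)

  ∑-*ʳ : (xs : List A) (u : A → ℤ) (c : ℤ) → ∑ xs (λ a → u a * c) ≡ ∑ xs u * c
  ∑-*ʳ [] u c = refl
  ∑-*ʳ (x ∷ xs) u c = trans (cong (_+_ (u x * c)) (∑-*ʳ xs u c))
    (solve 3 (λ a b c → a :* c :+ b :* c := (a :+ b) :* c) refl (u x) (∑ xs u) c)

∑-map : {A B : Set} (h : A → B) (xs : List A) (w : B → ℤ) → ∑ (map h xs) w ≡ ∑ xs (w ∘ h)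
∑-map h [] w = refl
∑-map h (x ∷ xs) w = cong (_+_ (w (h x))) (∑-map h xs w)

∑-concatMap : {A B : Set} (g : A → List B) (xs : List A) (w : B → ℤ) →
  ∑ (concatMap g xs) w ≡ ∑ xs (λ a → ∑ (g a) w)
∑-concatMap g [] w = refl
∑-concatMap g (x ∷ xs) w =
  trans (∑-++ (g x) (concatMap g xs) w) (cong (_+_ (∑ (g x) w)) (∑-concatMap g xs w))

asForest : Maybe Tree → Forest
asForest nothing = []
asForest (just t) = t ∷ []

∑F : Forest → (Forest → ℤ) → ℤ
∑F F w = ∑ (subF F) w

∑T : Tree → (Forest → ℤ) → ℤ
∑T t w = ∑ (subT t) (w ∘ asForest)

∑F-∷ : ∀ t ts (w : Forest → ℤ) →
  ∑F (t ∷ ts) w ≡ ∑ (subT t) (λ m → ∑F ts (λ f → w (asForest m ++ f)))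
∑F-∷ t ts w = trans (∑-concatMap _ (subT t) w)
  (∑-cong (subT t) (λ m → trans (∑-map _ (subF ts) w) (∑-cong (subF ts) (attach m))))
  where
  attach : ∀ m f → w (maybe (_∷ f) f m) ≡ w (asForest m ++ f)
  attach nothing f = refl
  attach (just u) f = refl

∑F-∷-multiplicative : (w : Forest → ℤ) → (∀ xs ys → w (xs ++ ys) ≡ w xs * w ys) →
  ∀ t ts → ∑F (t ∷ ts) w ≡ ∑T t w * ∑F ts w
∑F-∷-multiplicative w w-++ t ts = begin
  ∑F (t ∷ ts) w
    ≡⟨ ∑F-∷ t ts w ⟩
  ∑ (subT t) (λ m → ∑F ts (λ f → w (asForest m ++ f)))
    ≡⟨ ∑-cong (subT t) factor ⟩
  ∑ (subT t) (λ m → w (asForest m) * ∑F ts w)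
    ≡⟨ ∑-*ʳ (subT t) (w ∘ asForest) (∑F ts w) ⟩
  ∑T t w * ∑F ts w
    ∎
  where
  factor : ∀ m → ∑F ts (λ f → w (asForest m ++ f)) ≡ w (asForest m) * ∑F ts w
  factor m = trans (∑-cong (subF ts) (w-++ (asForest m))) (∑-*ˡ (subF ts) (w (asForest m)) w)

∑F-∷-leibniz : (w d : Forest → ℤ) → (∀ xs ys → d (xs ++ ys) ≡ d xs * w ys + w xs * d ys) →
  ∀ t ts → ∑F (t ∷ ts) d ≡ ∑T t d * ∑F ts w + ∑T t w * ∑F ts d
∑F-∷-leibniz w d d-++ t ts = begin
  ∑F (t ∷ ts) d
    ≡⟨ ∑F-∷ t ts d ⟩
  ∑ (subT t) (λ m → ∑F ts (λ f → d (asForest m ++ f)))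
    ≡⟨ ∑-cong (subT t) split ⟩
  ∑ (subT t) (λ m → d (asForest m) * ∑F ts w + w (asForest m) * ∑F ts d)
    ≡⟨ ∑-+ (subT t) _ _ ⟩
  ∑ (subT t) (λ m → d (asForest m) * ∑F ts w) + ∑ (subT t) (λ m → w (asForest m) * ∑F ts d)
    ≡⟨ cong₂ _+_ (∑-*ʳ (subT t) (d ∘ asForest) (∑F ts w)) (∑-*ʳ (subT t) (w ∘ asForest) (∑F ts d)) ⟩
  ∑T t d * ∑F ts w + ∑T t w * ∑F ts d
    ∎
  where
  split : ∀ m → ∑F ts (λ f → d (asForest m ++ f)) ≡ d (asForest m) * ∑F ts w + w (asForest m) * ∑F ts d
  split m = let xs = asForest m in begin
    ∑F ts (λ f → d (xs ++ f))
      ≡⟨ ∑-cong (subF ts) (d-++ xs) ⟩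
    ∑F ts (λ f → d xs * w f + w xs * d f)
      ≡⟨ ∑-+ (subF ts) _ _ ⟩
    ∑F ts (λ f → d xs * w f) + ∑F ts (λ f → w xs * d f)
      ≡⟨ cong₂ _+_ (∑-*ˡ (subF ts) (d xs) w) (∑-*ˡ (subF ts) (w xs) d) ⟩
    d xs * ∑F ts w + w xs * ∑F ts d
      ∎

rootedAt : Forest → Forest
rootedAt [] = []
rootedAt (u ∷ us) = node (u ∷ us) ∷ []

∑T-node : ∀ c cs (w : Forest → ℤ) → ∑T (node (c ∷ cs)) w ≡ ∑F (c ∷ cs) (w ∘ rootedAt)
∑T-node c cs w = trans (∑-map _ (subF (c ∷ cs)) (w ∘ asForest))
  (∑-cong (subF (c ∷ cs)) λ { [] → refl ; (u ∷ us) → refl })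

verticesF-++ : ∀ xs ys → verticesF (xs ++ ys) ≡ verticesF xs +ℕ verticesF ys
verticesF-++ [] ys = refl
verticesF-++ (x ∷ xs) ys =
  trans (cong (verticesT x +ℕ_) (verticesF-++ xs ys)) (sym (+ℕ-assoc (verticesT x) (verticesF xs) _))

leavesF-++ : ∀ xs ys → leavesF (xs ++ ys) ≡ leavesF xs +ℕ leavesF ys
leavesF-++ [] ys = refl
leavesF-++ (x ∷ xs) ys =
  trans (cong (leavesT x +ℕ_) (leavesF-++ xs ys)) (sym (+ℕ-assoc (leavesT x) (leavesF xs) _))

isEmpty : Forest → ℤ
isEmpty [] = + 1
isEmpty (_ ∷ _) = + 0

sign : Forest → ℤ
sign f = -1ℤ ^ leavesF f

weightedSign : Forest → ℤ
weightedSign f = + verticesF f * sign f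

isEmpty-++ : ∀ xs ys → isEmpty (xs ++ ys) ≡ isEmpty xs * isEmpty ys
isEmpty-++ [] ys = sym (*-identityˡ (isEmpty ys))
isEmpty-++ (x ∷ xs) ys = refl

sign-++ : ∀ xs ys → sign (xs ++ ys) ≡ sign xs * sign ys
sign-++ xs ys = trans (cong (-1ℤ ^_) (leavesF-++ xs ys)) (^-distribˡ-+-* -1ℤ (leavesF xs) (leavesF ys))

weightedSign-++ : ∀ xs ys → weightedSign (xs ++ ys) ≡ weightedSign xs * sign ys + sign xs * weightedSign ys
weightedSign-++ xs ys =
  trans (cong₂ _*_ (trans (cong +_ (verticesF-++ xs ys)) (pos-+ (verticesF xs) _)) (sign-++ xs ys))
  (solve 4 (λ a b c d → (a :+ b) :* (c :* d) := a :* c :* d :+ c :* (b :* d)) refl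
    (+ verticesF xs) (+ verticesF ys) (sign xs) (sign ys))

sign-rootedAt : ∀ f → sign (rootedAt f) ≡ sign f
sign-rootedAt [] = refl
sign-rootedAt (u ∷ us) = cong (-1ℤ ^_) (+ℕ-identityʳ (leavesF (u ∷ us)))

isEmpty-rootedAt : ∀ f → isEmpty (rootedAt f) ≡ isEmpty f
isEmpty-rootedAt [] = refl
isEmpty-rootedAt (u ∷ us) = refl

weightedSign-rootedAt : ∀ f → weightedSign (rootedAt f) ≡ weightedSign f + sign f - isEmpty f
weightedSign-rootedAt [] = refl
weightedSign-rootedAt f@(u ∷ us) = begin
  + (suc (verticesF f) +ℕ 0) * sign (rootedAt f)
    ≡⟨ cong₂ _*_ (cong +_ (+ℕ-identityʳ (suc (verticesF f)))) (sign-rootedAt f) ⟩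
  + (1 +ℕ verticesF f) * sign f
    ≡⟨ cong (_* sign f) (pos-+ 1 (verticesF f)) ⟩
  (+ 1 + + verticesF f) * sign f
    ≡⟨ solve 2 (λ v s → (con (+ 1) :+ v) :* s := v :* s :+ s :+ :- con (+ 0)) refl (+ verticesF f) (sign f) ⟩
  weightedSign f + sign f - + 0
    ∎

stemT-node : ∀ c cs → stemT (node (c ∷ cs)) ≡ suc (stem (c ∷ cs))
stemT-node c [] = refl
stemT-node c (_ ∷ _) = refl

stem-∷ : ∀ t ts → + stem (t ∷ ts) ≡ + stemT t * isEmpty ts
stem-∷ t [] = sym (*-identityʳ (+ stemT t))
stem-∷ t (_ ∷ _) = sym (*-zeroʳ (+ stemT t))

stem-nonTree : ∀ F → length F ≢ 1 → stem F ≡ 0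
stem-nonTree [] _ = refl
stem-nonTree (t ∷ []) ≢1 = ⊥-elim (≢1 refl)
stem-nonTree (t ∷ _ ∷ _) _ = refl

mutual
  ∑F-isEmpty : ∀ F → ∑F F isEmpty ≡ + 1
  ∑F-isEmpty [] = refl
  ∑F-isEmpty (t ∷ ts) = begin
    ∑F (t ∷ ts) isEmpty             ≡⟨ ∑F-∷-multiplicative isEmpty isEmpty-++ t ts ⟩
    ∑T t isEmpty * ∑F ts isEmpty    ≡⟨ cong₂ _*_ (∑T-isEmpty t) (∑F-isEmpty ts) ⟩
    + 1                             ∎

  ∑T-isEmpty : ∀ t → ∑T t isEmpty ≡ + 1
  ∑T-isEmpty (node []) = refl
  ∑T-isEmpty (node (c ∷ cs)) = begin
    ∑T (node (c ∷ cs)) isEmpty           ≡⟨ ∑T-node c cs isEmpty ⟩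
    ∑F (c ∷ cs) (isEmpty ∘ rootedAt)     ≡⟨ ∑-cong (subF (c ∷ cs)) isEmpty-rootedAt ⟩
    ∑F (c ∷ cs) isEmpty                  ≡⟨ ∑F-isEmpty (c ∷ cs) ⟩
    + 1                                  ∎

mutual
  ∑F-sign : ∀ F → ∑F F sign ≡ isEmpty F
  ∑F-sign [] = refl
  ∑F-sign (t ∷ ts) = begin
    ∑F (t ∷ ts) sign          ≡⟨ ∑F-∷-multiplicative sign sign-++ t ts ⟩
    ∑T t sign * ∑F ts sign    ≡⟨ cong (_* ∑F ts sign) (∑T-sign t) ⟩
    + 0                       ∎

  ∑T-sign : ∀ t → ∑T t sign ≡ + 0
  ∑T-sign (node []) = refl
  ∑T-sign (node (c ∷ cs)) = begin
    ∑T (node (c ∷ cs)) sign           ≡⟨ ∑T-node c cs sign ⟩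
    ∑F (c ∷ cs) (sign ∘ rootedAt)     ≡⟨ ∑-cong (subF (c ∷ cs)) sign-rootedAt ⟩
    ∑F (c ∷ cs) sign                  ≡⟨ ∑F-sign (c ∷ cs) ⟩
    + 0                               ∎

mutual
  ∑F-weightedSign : ∀ F → ∑F F weightedSign ≡ - + stem F
  ∑F-weightedSign [] = refl
  ∑F-weightedSign (t ∷ ts) = begin
    ∑F (t ∷ ts) weightedSign
      ≡⟨ ∑F-∷-leibniz sign weightedSign weightedSign-++ t ts ⟩
    ∑T t weightedSign * ∑F ts sign + ∑T t sign * ∑F ts weightedSign
      ≡⟨ cong₂ (λ a b → a * ∑F ts sign + b * ∑F ts weightedSign) (∑T-weightedSign t) (∑T-sign t) ⟩
    - + stemT t * ∑F ts sign + + 0 * ∑F ts weightedSign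
      ≡⟨ cong (λ e → - + stemT t * e + + 0 * ∑F ts weightedSign) (∑F-sign ts) ⟩
    - + stemT t * isEmpty ts + + 0 * ∑F ts weightedSign
      ≡⟨ solve 3 (λ s e w → :- s :* e :+ con (+ 0) :* w := :- (s :* e)) refl
           (+ stemT t) (isEmpty ts) (∑F ts weightedSign) ⟩
    - (+ stemT t * isEmpty ts)
      ≡⟨ cong -_ (sym (stem-∷ t ts)) ⟩
    - + stem (t ∷ ts)
      ∎

  ∑T-weightedSign : ∀ t → ∑T t weightedSign ≡ - + stemT t
  ∑T-weightedSign (node []) = refl
  ∑T-weightedSign (node (c ∷ cs)) = let F = c ∷ cs in begin
    ∑T (node F) weightedSign
      ≡⟨ ∑T-node c cs weightedSign ⟩
    ∑F F (weightedSign ∘ rootedAt)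
      ≡⟨ ∑-cong (subF F) weightedSign-rootedAt ⟩
    ∑F F (λ f → weightedSign f + sign f - isEmpty f)
      ≡⟨ ∑-+ (subF F) _ _ ⟩
    ∑F F (λ f → weightedSign f + sign f) + ∑F F (λ f → - isEmpty f)
      ≡⟨ cong₂ _+_ (∑-+ (subF F) weightedSign sign) (∑-neg (subF F) isEmpty) ⟩
    ∑F F weightedSign + ∑F F sign - ∑F F isEmpty
      ≡⟨ cong₂ (λ a b → a + b - ∑F F isEmpty) (∑F-weightedSign F) (∑F-sign F) ⟩
    - + stem F + + 0 - ∑F F isEmpty
      ≡⟨ cong (λ e → - + stem F + + 0 - e) (∑F-isEmpty F) ⟩
    - + stem F + + 0 - + 1
      ≡⟨ solve 1 (λ s → :- s :+ con (+ 0) :+ :- con (+ 1) := :- (con (+ 1) :+ s)) refl (+ stem F) ⟩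
    - (+ 1 + + stem F)
      ≡⟨ cong -_ (trans (sym (pos-+ 1 (stem F))) (cong +_ (sym (stemT-node c cs)))) ⟩
    - + stemT (node F)
      ∎

dxEval-P : ∀ F → dxEval (P F) (+ 1) -1ℤ ≡ ∑F F weightedSign
dxEval-P F = go (subF F)
  where
  go : ∀ L → dxEval (map (λ F' → (+ 1 , verticesF F' , leavesF F')) L) (+ 1) -1ℤ ≡ ∑ L weightedSign
  go [] = refl
  go (f ∷ L) = cong₂ _+_ term (go L)
    where
    term : + 1 * + verticesF f * 1ℤ ^ (verticesF f ∸ 1) * sign f ≡ weightedSign f
    term = trans (cong (λ e → + 1 * + verticesF f * e * sign f) (^-zeroˡ (verticesF f ∸ 1)))
      (solve 2 (λ v s → con (+ 1) :* v :* con (+ 1) :* s := v :* s) refl (+ verticesF f) (sign f))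

derivEval-at-minusOne : (h : ℤ × ℕ × ℕ → ℤ × ℕ) → (∀ c a b → h (c , a , b) ≡ (- (c * -1ℤ ^ b) , a)) →
  ∀ ms → derivEval (map h ms) (+ 1) ≡ - dxEval ms (+ 1) -1ℤ
derivEval-at-minusOne h h≡ [] = refl
derivEval-at-minusOne h h≡ ((c , a , b) ∷ ms) rewrite h≡ c a b =
  trans (cong (_+_ (- (c * -1ℤ ^ b) * + a * 1ℤ ^ (a ∸ 1))) (derivEval-at-minusOne h h≡ ms))
    (solve 5 (λ c a s e r → :- (c :* s) :* a :* e :+ :- r := :- (c :* a :* e :* s :+ r)) refl
      c (+ a) (-1ℤ ^ b) (1ℤ ^ (a ∸ 1)) (dxEval ms (+ 1) -1ℤ))

derivEval-p : ∀ F → derivEval (p F) (+ 1) ≡ - dxEval (P F) (+ 1) -1ℤ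
derivEval-p F = trans (+-identityˡ _) (derivEval-at-minusOne _ (λ _ _ _ → refl) (P F))

lemma5p2 : (F : Forest) →
    ((+ stem F ≡ derivEval (p F) (+ 1))
      × (+ stem F ≡ - dxEval (P F) (+ 1) (- (+ 1))))
    × (length F ≢ 1 → dxEval (P F) (+ 1) (- (+ 1)) ≡ + 0)
lemma5p2 F = (stem≡p′ , stem≡-∂ₓP) , ∂ₓP≡0
  where
  ∂ₓP≡-stem : dxEval (P F) (+ 1) -1ℤ ≡ - + stem F
  ∂ₓP≡-stem = trans (dxEval-P F) (∑F-weightedSign F)

  stem≡-∂ₓP : + stem F ≡ - dxEval (P F) (+ 1) -1ℤ
  stem≡-∂ₓP = trans (sym (neg-involutive (+ stem F))) (cong -_ (sym ∂ₓP≡-stem))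

  stem≡p′ : + stem F ≡ derivEval (p F) (+ 1)
  stem≡p′ = trans stem≡-∂ₓP (sym (derivEval-p F))

  ∂ₓP≡0 : length F ≢ 1 → dxEval (P F) (+ 1) -1ℤ ≡ + 0
  ∂ₓP≡0 ≢1 = trans ∂ₓP≡-stem (cong (-_ ∘ +_) (stem-nonTree F ≢1))
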